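{- Let $G=(A_1,A_2,E)$ be a finite complete bipartite graph, and let $\{ G^i = (B_1^i,B_2^i,E^i) \}_{i \in [m]}$ be a decomposition of $G$ into $m$ complete bipartite subgraphs. Assume that for every vertex $x \in A_1$ there is $i \in [m]$ such that $B_1^i = \{x\}$, and for every vertex $x \in A_2$ there is $i \in [m]$ such that $B_2^i = \{x\}$. Then $m \ge |A_1|+|A_2|-1$.
   Context: $G$ has vertex classes $A_1,A_2$ and edge set $E = A_1\times A_2$. A complete bipartite subgraph $G^i=(B_1^i,B_2^i,E^i)$ has $B_1^i\subseteq A_1$, $B_2^i\subseteq A_2$, and $E^i = B_1^i\times B_2^i$. A decomposition means the edge sets $E^1,\ldots,E^m$ are pairwise disjoint and their union is $E$. -}

module Defs where

open import Data.Nat using (ℕ)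
open import Data.Fin using (Fin)
open import Data.Fin.Subset using (Subset; _∈_; ⁅_⁆)
open import Data.Product using (Σ; _×_; ∃)
open import Relation.Binary.PropositionalEquality using (_≡_)

-- A complete bipartite graph G = (A₁, A₂, A₁ × A₂) with A₁ = Fin n₁, A₂ = Fin n₂.
-- A family of m complete bipartite subgraphs G^i = (B₁ i, B₂ i, B₁ i × B₂ i), i : Fin m.

EdgeIn : ∀ {n₁ n₂ m} → (Fin m → Subset n₁) → (Fin m → Subset n₂) →
         Fin m → Fin n₁ → Fin n₂ → Set
EdgeIn B₁ B₂ i x y = (x ∈ B₁ i) × (y ∈ B₂ i)

IsDecomposition : ∀ {n₁ n₂ m} → (Fin m → Subset n₁) → (Fin m → Subset n₂) → Set
IsDecomposition {n₁} {n₂} {m} B₁ B₂ =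
  ((x : Fin n₁) (y : Fin n₂) → ∃ λ i → EdgeIn B₁ B₂ i x y)
  × ((i j : Fin m) (x : Fin n₁) (y : Fin n₂) →
       EdgeIn B₁ B₂ i x y → EdgeIn B₁ B₂ j x y → i ≡ j)

-- Suppose n₁ + n₂ > m + 1.  The m + 1 homogeneous equations  Σₓ a x = 0  and
-- αᵢ + βᵢ = 0 (i < m), where αᵢ and βᵢ are the total weights of B₁ i under a and
-- of B₂ i under b, then have a nonzero integer solution (a , b).  Every edge lies
-- in exactly one biclique, so Σᵢ αᵢ βᵢ = (Σ a)(Σ b) = 0, hence Σᵢ αᵢ² = 0 and all
-- αᵢ, βᵢ vanish.  But each a x and b y is one of the αᵢ or βᵢ, namely the one of
-- a star with a single vertex on that side.
module Submission where

open import Defs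

module IntegerLinearAlgebra where

  open import Data.Nat as ℕ using (zero; suc; _<_; s≤s)
  import Data.Nat.Properties as ℕ
  open import Data.Integer using (ℤ; +_; -[1+_]; 0ℤ; 1ℤ; _+_; _*_; -_; _-_; _≤_; +≤+; _≟_)
  open import Data.Integer.Properties as ℤ using (+-*-semiring)
  open import Data.Integer.Solver using (module +-*-Solver)
  open import Data.Fin using (Fin; zero; suc; punchIn; _↑ˡ_; _↑ʳ_; splitAt; join)
  open import Data.Fin.Properties using (punchInᵢ≢i; all?; ¬∀⟶∃¬; join-splitAt)
  open import Data.Vec.Functional using (Vector; _++_; insertAt; removeAt)
  open import Data.Vec.Functional.Properties using (insertAt-lookup; insertAt-punchIn; lookup-++ˡ; lookup-++ʳ)
  open import Data.Product using (∃; _×_; _,_)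
  open import Data.Sum using (inj₁; inj₂; [_,_])
  open import Function using (_∘_)
  open import Relation.Nullary using (yes; no; contradiction)
  open import Relation.Binary.PropositionalEquality
  open import Algebra.Properties.Semiring.Sum +-*-semiring public
    using (sum; sum-cong-≗; sum-remove; ∑-distrib-+; ∑-comm; *-distribˡ-sum; *-distribʳ-sum)
  open import Algebra.Properties.Semiring.Sum +-*-semiring
    using (sum-replicate-zero)
  open +-*-Solver

  ∑-zero : ∀ {n} {f : Vector ℤ n} → (∀ i → f i ≡ 0ℤ) → sum f ≡ 0ℤ
  ∑-zero {n} f≡0 = trans (sum-cong-≗ f≡0) (sum-replicate-zero n)

  ∑-single : ∀ {n} (j : Fin n) {f : Vector ℤ n} → (∀ i → i ≢ j → f i ≡ 0ℤ) → sum f ≡ f j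
  ∑-single {suc n} j {f} f≡0 = begin
    sum f                       ≡⟨ sum-remove f ⟩
    f j + sum (removeAt f j)    ≡⟨ cong (_+_ (f j)) (∑-zero (λ i → f≡0 (punchIn j i) (punchInᵢ≢i j i))) ⟩
    f j + 0ℤ                    ≡⟨ ℤ.+-identityʳ (f j) ⟩
    f j                         ∎
    where open ≡-Reasoning

  ∑-↑ : ∀ {m n} (f : Vector ℤ (m ℕ.+ n)) → sum f ≡ sum (f ∘ (_↑ˡ n)) + sum (f ∘ (m ↑ʳ_))
  ∑-↑ {zero}  f = sym (ℤ.+-identityˡ (sum f))
  ∑-↑ {suc m} {n} f = trans (cong (_+_ (f zero)) (∑-↑ {m} {n} (f ∘ suc))) (sym (ℤ.+-assoc (f zero) _ _))

  x+y≡0⇒x≡0 : ∀ {x y} → 0ℤ ≤ x → 0ℤ ≤ y → x + y ≡ 0ℤ → x ≡ 0ℤ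
  x+y≡0⇒x≡0 {x} {y} 0≤x 0≤y x+y≡0 = ℤ.≤-antisym x≤0 0≤x
    where
    open ℤ.≤-Reasoning
    x≤0 : x ≤ 0ℤ
    x≤0 = begin
      x       ≡⟨ ℤ.+-identityʳ x ⟨
      x + 0ℤ  ≤⟨ ℤ.+-monoʳ-≤ x 0≤y ⟩
      x + y   ≡⟨ x+y≡0 ⟩
      0ℤ      ∎

  ∑-nonneg : ∀ {n} {f : Vector ℤ n} → (∀ i → 0ℤ ≤ f i) → 0ℤ ≤ sum f
  ∑-nonneg {zero}  0≤f = +≤+ ℕ.z≤n
  ∑-nonneg {suc n} 0≤f = ℤ.+-mono-≤ (0≤f zero) (∑-nonneg (0≤f ∘ suc))

  ∑-nonneg≡0 : ∀ {n} {f : Vector ℤ n} → (∀ i → 0ℤ ≤ f i) → sum f ≡ 0ℤ → ∀ i → f i ≡ 0ℤ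
  ∑-nonneg≡0 0≤f ∑f≡0 zero =
    x+y≡0⇒x≡0 (0≤f zero) (∑-nonneg (0≤f ∘ suc)) ∑f≡0
  ∑-nonneg≡0 {f = f} 0≤f ∑f≡0 (suc i) =
    ∑-nonneg≡0 (0≤f ∘ suc) (x+y≡0⇒x≡0 (∑-nonneg (0≤f ∘ suc)) (0≤f zero)
      (trans (ℤ.+-comm _ (f zero)) ∑f≡0)) i

  0≤i*i : ∀ i → 0ℤ ≤ i * i
  0≤i*i (+ n)      = subst (0ℤ ≤_) (sym (ℤ.+◃n≡+n (n ℕ.* n))) (+≤+ ℕ.z≤n)
  0≤i*i -[1+ n ]   = subst (0ℤ ≤_) (sym (ℤ.+◃n≡+n (suc n ℕ.* suc n))) (+≤+ ℕ.z≤n)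

  ∑-squares≡0 : ∀ {n} (f : Vector ℤ n) → sum (λ i → f i * f i) ≡ 0ℤ → ∀ i → f i ≡ 0ℤ
  ∑-squares≡0 f ∑f²≡0 i with ℤ.i*j≡0⇒i≡0∨j≡0 (f i) (∑-nonneg≡0 (0≤i*i ∘ f) ∑f²≡0 i)
  ... | inj₁ fi≡0 = fi≡0
  ... | inj₂ fi≡0 = fi≡0

  infix 7 _·_
  _·_ : ∀ {n} → Vector ℤ n → Vector ℤ n → ℤ
  u · v = sum (λ i → u i * v i)

  ·-++ : ∀ {m n} (u : Vector ℤ m) (w : Vector ℤ n) (v : Vector ℤ (m ℕ.+ n)) →
         (u ++ w) · v ≡ u · (v ∘ (_↑ˡ n)) + w · (v ∘ (m ↑ʳ_))
  ·-++ {m} {n} u w v = trans (∑-↑ {m} {n} (λ i → (u ++ w) i * v i))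
    (cong₂ _+_ (sum-cong-≗ (λ i → cong (_* v (i ↑ˡ n)) (lookup-++ˡ u w i)))
               (sum-cong-≗ (λ i → cong (_* v (m ↑ʳ i)) (lookup-++ʳ u w i))))

  ↑-vanishing : ∀ {m n} (v : Vector ℤ (m ℕ.+ n)) →
                (∀ x → v (x ↑ˡ n) ≡ 0ℤ) → (∀ y → v (m ↑ʳ y) ≡ 0ℤ) → ∀ i → v i ≡ 0ℤ
  ↑-vanishing {m} {n} v left right i = subst (λ k → v k ≡ 0ℤ) (join-splitAt m n i)
    ([_,_] {C = λ s → v (join m n s) ≡ 0ℤ} left right (splitAt m i))

  Solves : ∀ {m n} → (Fin m → Vector ℤ n) → Vector ℤ n → Set
  Solves E v = ∀ t → E t · v ≡ 0ℤ

  Nontrivial : ∀ {n} → Vector ℤ n → Set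
  Nontrivial v = ∃ λ i → v i ≢ 0ℤ

  -- Cross-multiplying by the pivot c j removes unknown j from every other row;
  -- back substitution scales the reduced solution by c j so that no division occurs.
  eliminate : ∀ {n} → Fin (suc n) → Vector ℤ (suc n) → Vector ℤ (suc n) → Vector ℤ n
  eliminate j c d i = c j * d (punchIn j i) - d j * c (punchIn j i)

  eliminate-self : ∀ {n} (j : Fin (suc n)) (c : Vector ℤ (suc n)) i → eliminate j c c i ≡ 0ℤ
  eliminate-self j c i = ℤ.+-inverseʳ (c j * c (punchIn j i))

  backSubstitute : ∀ {n} → Fin (suc n) → Vector ℤ (suc n) → Vector ℤ n → Vector ℤ (suc n)
  backSubstitute j c w = insertAt (λ i → c j * w i) j (- (removeAt c j · w))

  ·-eliminate : ∀ {n} (j : Fin (suc n)) (c d : Vector ℤ (suc n)) (w : Vector ℤ n) →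
                eliminate j c d · w ≡ c j * (removeAt d j · w) + - d j * (removeAt c j · w)
  ·-eliminate j c d w = begin
    sum (λ i → (c j * d′ i - d j * c′ i) * w i)
      ≡⟨ sum-cong-≗ (λ i → expand (c j) (d j) (d′ i) (c′ i) (w i)) ⟩
    sum (λ i → c j * (d′ i * w i) + - d j * (c′ i * w i))
      ≡⟨ ∑-distrib-+ (λ i → c j * (d′ i * w i)) (λ i → - d j * (c′ i * w i)) ⟩
    sum (λ i → c j * (d′ i * w i)) + sum (λ i → - d j * (c′ i * w i))
      ≡⟨ cong₂ _+_ (*-distribˡ-sum (c j) (λ i → d′ i * w i)) (*-distribˡ-sum (- d j) (λ i → c′ i * w i)) ⟨
    c j * (d′ · w) + - d j * (c′ · w) ∎
    where
    open ≡-Reasoning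
    d′ = removeAt d j
    c′ = removeAt c j
    expand : ∀ a b x y z → (a * x - b * y) * z ≡ a * (x * z) + - b * (y * z)
    expand = solve 5 (λ a b x y z → (a :* x :- b :* y) :* z := a :* (x :* z) :+ :- b :* (y :* z)) refl

  ·-backSubstitute : ∀ {n} (j : Fin (suc n)) (c d : Vector ℤ (suc n)) (w : Vector ℤ n) →
                     d · backSubstitute j c w ≡ eliminate j c d · w
  ·-backSubstitute j c d w = begin
    d · v
      ≡⟨ sum-remove (λ i → d i * v i) ⟩
    d j * v j + sum (λ i → d′ i * v (punchIn j i))
      ≡⟨ cong₂ _+_ (cong (d j *_) (insertAt-lookup _ j _))
                   (sum-cong-≗ (λ i → cong (d′ i *_) (insertAt-punchIn _ j _ i))) ⟩
    d j * - (c′ · w) + sum (λ i → d′ i * (c j * w i))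
      ≡⟨ cong (_+_ (d j * - (c′ · w))) (sum-cong-≗ (λ i → swap (d′ i) (c j) (w i))) ⟩
    d j * - (c′ · w) + sum (λ i → c j * (d′ i * w i))
      ≡⟨ cong (_+_ (d j * - (c′ · w))) (*-distribˡ-sum (c j) (λ i → d′ i * w i)) ⟨
    d j * - (c′ · w) + c j * (d′ · w)
      ≡⟨ rearrange (d j) (c′ · w) (c j) (d′ · w) ⟩
    c j * (d′ · w) + - d j * (c′ · w)
      ≡⟨ ·-eliminate j c d w ⟨
    eliminate j c d · w ∎
    where
    open ≡-Reasoning
    v = backSubstitute j c w
    d′ = removeAt d j
    c′ = removeAt c j
    swap : ∀ x y z → x * (y * z) ≡ y * (x * z)
    swap = solve 3 (λ x y z → x :* (y :* z) := y :* (x :* z)) refl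
    rearrange : ∀ a s b t → a * - s + b * t ≡ b * t + - a * s
    rearrange = solve 4 (λ a s b t → a :* :- s :+ b :* t := b :* t :+ :- a :* s) refl

  nontrivial-solution : ∀ {m n} → m < n → (E : Fin m → Vector ℤ n) →
                        ∃ λ v → Solves E v × Nontrivial v
  nontrivial-solution {zero} {suc n} _ E = (λ _ → 1ℤ) , (λ ()) , zero , λ ()
  nontrivial-solution {suc m} {suc n} (s≤s m<n) E with all? (λ j → E zero j ≟ 0ℤ)
  ... | yes E₀≡0 with nontrivial-solution (ℕ.m<n⇒m<1+n m<n) (E ∘ suc)
  ...   | v , solves , nontrivial = v , solves′ , nontrivial
    where
    solves′ : Solves E v
    solves′ zero    = ∑-zero (λ i → trans (cong (_* v i) (E₀≡0 i)) (ℤ.*-zeroˡ (v i)))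
    solves′ (suc t) = solves t
  nontrivial-solution {suc m} {suc n} (s≤s m<n) E | no E₀≢0
    with ¬∀⟶∃¬ _ _ (λ j → E zero j ≟ 0ℤ) E₀≢0
  ... | j , cⱼ≢0 with nontrivial-solution m<n (eliminate j (E zero) ∘ E ∘ suc)
  ...   | w , solves , i , wᵢ≢0 = backSubstitute j c w , solves′ , punchIn j i , nonzero
    where
    c = E zero
    solves′ : Solves E (backSubstitute j c w)
    solves′ zero    = trans (·-backSubstitute j c c w)
      (∑-zero (λ i → trans (cong (_* w i) (eliminate-self j c i)) (ℤ.*-zeroˡ (w i))))
    solves′ (suc t) = trans (·-backSubstitute j c (E (suc t)) w) (solves t)
    nonzero : backSubstitute j c w (punchIn j i) ≢ 0ℤ
    nonzero eq with ℤ.i*j≡0⇒i≡0∨j≡0 (c j) (trans (sym (insertAt-punchIn _ j _ i)) eq)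
    ... | inj₁ cⱼ≡0 = cⱼ≢0 cⱼ≡0
    ... | inj₂ wᵢ≡0 = wᵢ≢0 wᵢ≡0

  only-trivial-solution⇒≤ : ∀ {m n} (E : Fin m → Vector ℤ n) →
                             (∀ v → Solves E v → ∀ i → v i ≡ 0ℤ) → n ℕ.≤ m
  only-trivial-solution⇒≤ {m} {n} E trivial with n ℕ.≤? m
  ... | yes n≤m = n≤m
  ... | no n≰m with nontrivial-solution (ℕ.≰⇒> n≰m) E
  ...   | v , solves , i , vᵢ≢0 = contradiction (trivial v solves i) vᵢ≢0

module BicliqueDecompositions where

  open IntegerLinearAlgebra
  open import Data.Integer using (ℤ; 0ℤ; 1ℤ; _+_; _*_)
  import Data.Integer.Properties as ℤ
  open import Data.Integer.Solver using (module +-*-Solver)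
  open import Data.Bool using (if_then_else_)
  open import Function using (_∘_)
  open import Data.Fin using (Fin)
  open import Data.Fin.Subset using (Subset; _∈_; ⁅_⁆)
  open import Data.Fin.Subset.Properties using (_∈?_; x∈⁅x⁆; x∈⁅y⁆⇒x≡y)
  open import Data.Vec.Functional using (Vector)
  open import Data.Product using (∃; _×_; _,_)
  open import Relation.Nullary using (¬_; does; yes; no; contradiction)
  open import Relation.Binary.PropositionalEquality
  open +-*-Solver

  indicator : ∀ {n} → Subset n → Vector ℤ n
  indicator S x = if does (x ∈? S) then 1ℤ else 0ℤ

  indicator-∈ : ∀ {n} {S : Subset n} {x} → x ∈ S → indicator S x ≡ 1ℤ
  indicator-∈ {S = S} {x} x∈S with x ∈? S
  ... | yes _   = refl
  ... | no x∉S = contradiction x∈S x∉S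

  indicator-*-≡0 : ∀ {p q} {S : Subset p} {T : Subset q} {x y} →
                  ¬ (x ∈ S × y ∈ T) → indicator S x * indicator T y ≡ 0ℤ
  indicator-*-≡0 {S = S} {T} {x} {y} ∉ with x ∈? S | y ∈? T
  ... | yes x∈S | yes y∈T = contradiction (x∈S , y∈T) ∉
  ... | yes _   | no _    = refl
  ... | no _    | _       = refl

  indicator-⁅⁆-· : ∀ {n} (x : Fin n) (a : Vector ℤ n) → indicator ⁅ x ⁆ · a ≡ a x
  indicator-⁅⁆-· x a = begin
    indicator ⁅ x ⁆ · a        ≡⟨ ∑-single x (λ y y≢x → cong (_* a y) (y∉⁅x⁆ y y≢x)) ⟩
    indicator ⁅ x ⁆ x * a x    ≡⟨ cong (_* a x) (indicator-∈ (x∈⁅x⁆ x)) ⟩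
    1ℤ * a x                   ≡⟨ ℤ.*-identityˡ (a x) ⟩
    a x                        ∎
    where
    open ≡-Reasoning
    y∉⁅x⁆ : ∀ y → y ≢ x → indicator ⁅ x ⁆ y ≡ 0ℤ
    y∉⁅x⁆ y y≢x with y ∈? ⁅ x ⁆
    ... | yes y∈⁅x⁆ = contradiction (x∈⁅y⁆⇒x≡y x y∈⁅x⁆) y≢x
    ... | no _      = refl

  decomposition-covers-once : ∀ {n₁ n₂ m} {B₁ : Fin m → Subset n₁} {B₂ : Fin m → Subset n₂} →
    IsDecomposition B₁ B₂ → ∀ x y → sum (λ i → indicator (B₁ i) x * indicator (B₂ i) y) ≡ 1ℤ
  decomposition-covers-once {B₁ = B₁} {B₂} (cover , disjoint) x y with cover x y
  ... | i , x∈B₁ᵢ , y∈B₂ᵢ = begin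
    sum (λ j → indicator (B₁ j) x * indicator (B₂ j) y)
      ≡⟨ ∑-single i (λ j j≢i → indicator-*-≡0 (λ e → j≢i (disjoint j i x y e (x∈B₁ᵢ , y∈B₂ᵢ)))) ⟩
    indicator (B₁ i) x * indicator (B₂ i) y
      ≡⟨ cong₂ _*_ (indicator-∈ x∈B₁ᵢ) (indicator-∈ y∈B₂ᵢ) ⟩
    1ℤ ∎
    where open ≡-Reasoning

  ∑-·*· : ∀ {m p q} (u : Fin m → Vector ℤ p) (w : Fin m → Vector ℤ q) a b →
            sum (λ i → (u i · a) * (w i · b))
              ≡ sum (λ x → sum (λ y → sum (λ i → u i x * w i y) * (a x * b y)))
  ∑-·*· u w a b = begin
    sum (λ i → (u i · a) * (w i · b))
      ≡⟨ sum-cong-≗ (λ i → *-distribʳ-sum (w i · b) (λ x → u i x * a x)) ⟩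
    sum (λ i → sum (λ x → (u i x * a x) * (w i · b)))
      ≡⟨ sum-cong-≗ (λ i → sum-cong-≗ (λ x → *-distribˡ-sum (u i x * a x) (λ y → w i y * b y))) ⟩
    sum (λ i → sum (λ x → sum (λ y → (u i x * a x) * (w i y * b y))))
      ≡⟨ ∑-comm (λ i x → sum (λ y → (u i x * a x) * (w i y * b y))) ⟩
    sum (λ x → sum (λ i → sum (λ y → (u i x * a x) * (w i y * b y))))
      ≡⟨ sum-cong-≗ (λ x → ∑-comm (λ i y → (u i x * a x) * (w i y * b y))) ⟩
    sum (λ x → sum (λ y → sum (λ i → (u i x * a x) * (w i y * b y))))
      ≡⟨ sum-cong-≗ (λ x → sum-cong-≗ (λ y → sum-cong-≗ (λ i →
           regroup (u i x) (a x) (w i y) (b y)))) ⟩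
    sum (λ x → sum (λ y → sum (λ i → (u i x * w i y) * (a x * b y))))
      ≡⟨ sum-cong-≗ (λ x → sum-cong-≗ (λ y → *-distribʳ-sum (a x * b y) (λ i → u i x * w i y))) ⟨
    sum (λ x → sum (λ y → sum (λ i → u i x * w i y) * (a x * b y))) ∎
    where
    open ≡-Reasoning
    regroup : ∀ s t s′ t′ → (s * t) * (s′ * t′) ≡ (s * s′) * (t * t′)
    regroup = solve 4 (λ s t s′ t′ → (s :* t) :* (s′ :* t′) := (s :* s′) :* (t :* t′)) refl

  decomposition-∑-products : ∀ {n₁ n₂ m} {B₁ : Fin m → Subset n₁} {B₂ : Fin m → Subset n₂} →
    IsDecomposition B₁ B₂ → ∀ a b →
    sum (λ i → (indicator (B₁ i) · a) * (indicator (B₂ i) · b)) ≡ sum a * sum b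
  decomposition-∑-products {B₁ = B₁} {B₂} decomposition a b = begin
    sum (λ i → (indicator (B₁ i) · a) * (indicator (B₂ i) · b))
      ≡⟨ ∑-·*· (indicator ∘ B₁) (indicator ∘ B₂) a b ⟩
    sum (λ x → sum (λ y → sum (λ i → indicator (B₁ i) x * indicator (B₂ i) y) * (a x * b y)))
      ≡⟨ sum-cong-≗ (λ x → sum-cong-≗ (λ y →
           trans (cong (_* (a x * b y)) (decomposition-covers-once decomposition x y))
                 (ℤ.*-identityˡ (a x * b y)))) ⟩
    sum (λ x → sum (λ y → a x * b y))
      ≡⟨ sum-cong-≗ (λ x → *-distribˡ-sum (a x) b) ⟨
    sum (λ x → a x * sum b)
      ≡⟨ *-distribʳ-sum (sum b) a ⟨
    sum a * sum b ∎
    where open ≡-Reasoning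

  balanced-weights-vanish : ∀ {n₁ n₂ m} {B₁ : Fin m → Subset n₁} {B₂ : Fin m → Subset n₂} →
    IsDecomposition B₁ B₂ →
    ((x : Fin n₁) → ∃ λ i → B₁ i ≡ ⁅ x ⁆) →
    ((y : Fin n₂) → ∃ λ i → B₂ i ≡ ⁅ y ⁆) →
    ∀ a b → sum a ≡ 0ℤ → (∀ i → indicator (B₁ i) · a + indicator (B₂ i) · b ≡ 0ℤ) →
    (∀ x → a x ≡ 0ℤ) × (∀ y → b y ≡ 0ℤ)
  balanced-weights-vanish {m = m} {B₁} {B₂} decomposition star₁ star₂ a b ∑a≡0 balanced =
    a≡0 , b≡0
    where
    open ≡-Reasoning
    α β : Fin m → ℤ
    α i = indicator (B₁ i) · a
    β i = indicator (B₂ i) · b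

    ∑αβ≡0 : sum (λ i → α i * β i) ≡ 0ℤ
    ∑αβ≡0 = begin
      sum (λ i → α i * β i)  ≡⟨ decomposition-∑-products decomposition a b ⟩
      sum a * sum b          ≡⟨ cong (_* sum b) ∑a≡0 ⟩
      0ℤ * sum b             ≡⟨ ℤ.*-zeroˡ (sum b) ⟩
      0ℤ                     ∎

    ∑α²≡0 : sum (λ i → α i * α i) ≡ 0ℤ
    ∑α²≡0 = begin
      sum (λ i → α i * α i)                          ≡⟨ ℤ.+-identityʳ _ ⟨
      sum (λ i → α i * α i) + 0ℤ                     ≡⟨ cong (_+_ (sum (λ i → α i * α i))) ∑αβ≡0 ⟨
      sum (λ i → α i * α i) + sum (λ i → α i * β i)  ≡⟨ ∑-distrib-+ (λ i → α i * α i) (λ i → α i * β i) ⟨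
      sum (λ i → α i * α i + α i * β i)              ≡⟨ sum-cong-≗ (λ i → ℤ.*-distribˡ-+ (α i) (α i) (β i)) ⟨
      sum (λ i → α i * (α i + β i))                  ≡⟨ ∑-zero (λ i → trans (cong (α i *_) (balanced i)) (ℤ.*-zeroʳ (α i))) ⟩
      0ℤ                                             ∎

    α≡0 : ∀ i → α i ≡ 0ℤ
    α≡0 = ∑-squares≡0 α ∑α²≡0

    β≡0 : ∀ i → β i ≡ 0ℤ
    β≡0 i = begin
      β i         ≡⟨ ℤ.+-identityˡ (β i) ⟨
      0ℤ + β i    ≡⟨ cong (_+ β i) (α≡0 i) ⟨
      α i + β i   ≡⟨ balanced i ⟩
      0ℤ          ∎

    a≡0 : ∀ x → a x ≡ 0ℤ
    a≡0 x with star₁ x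
    ... | i , B₁ᵢ≡⁅x⁆ = begin
      a x                   ≡⟨ indicator-⁅⁆-· x a ⟨
      indicator ⁅ x ⁆ · a   ≡⟨ cong (λ S → indicator S · a) B₁ᵢ≡⁅x⁆ ⟨
      α i                   ≡⟨ α≡0 i ⟩
      0ℤ                    ∎

    b≡0 : ∀ y → b y ≡ 0ℤ
    b≡0 y with star₂ y
    ... | i , B₂ᵢ≡⁅y⁆ = begin
      b y                   ≡⟨ indicator-⁅⁆-· y b ⟨
      indicator ⁅ y ⁆ · b   ≡⟨ cong (λ S → indicator S · b) B₂ᵢ≡⁅y⁆ ⟨
      β i                   ≡⟨ β≡0 i ⟩
      0ℤ                    ∎

open IntegerLinearAlgebra
  using (sum; sum-cong-≗; ∑-zero; _·_; ·-++; ↑-vanishing; Solves; only-trivial-solution⇒≤)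
open BicliqueDecompositions using (indicator; balanced-weights-vanish)

open import Data.Nat using (ℕ; suc; _+_; _≤_)
import Data.Nat.Properties as ℕ
open import Data.Integer using (ℤ; 0ℤ; 1ℤ) renaming (_+_ to _+ℤ_)
import Data.Integer.Properties as ℤ
open import Data.Fin using (Fin; zero; suc; _↑ˡ_; _↑ʳ_)
open import Data.Fin.Subset using (Subset; ⁅_⁆)
open import Data.Vec.Functional using (Vector; _++_; replicate)
open import Data.Product using (∃; _×_; _,_)
open import Function using (_∘_)
open import Relation.Binary.PropositionalEquality using (_≡_; sym; trans; cong₂; subst; module ≡-Reasoning)

system : ∀ {n₁ n₂ m} → (Fin m → Subset n₁) → (Fin m → Subset n₂) → Fin (suc m) → Vector ℤ (n₁ + n₂)
system {n₁} {n₂} B₁ B₂ zero = replicate n₁ 1ℤ ++ replicate n₂ 0ℤ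
system B₁ B₂ (suc i)       = indicator (B₁ i) ++ indicator (B₂ i)

system-solution-balanced : ∀ {n₁ n₂ m} (B₁ : Fin m → Subset n₁) (B₂ : Fin m → Subset n₂) v →
  Solves (system B₁ B₂) v →
  sum (v ∘ (_↑ˡ n₂)) ≡ 0ℤ ×
  (∀ i → indicator (B₁ i) · (v ∘ (_↑ˡ n₂)) +ℤ indicator (B₂ i) · (v ∘ (n₁ ↑ʳ_)) ≡ 0ℤ)
system-solution-balanced {n₁} {n₂} B₁ B₂ v solves = ∑a≡0 , balanced
  where
  a = v ∘ (_↑ˡ n₂)
  b = v ∘ (n₁ ↑ʳ_)
  ∑a≡0 : sum a ≡ 0ℤ
  ∑a≡0 = begin
    sum a                                          ≡⟨ ℤ.+-identityʳ (sum a) ⟨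
    sum a +ℤ 0ℤ                                    ≡⟨ cong₂ _+ℤ_ (sum-cong-≗ {n₁} (λ x → ℤ.*-identityˡ (a x)))
                                                                 (∑-zero {n₂} (λ y → ℤ.*-zeroˡ (b y))) ⟨
    replicate n₁ 1ℤ · a +ℤ replicate n₂ 0ℤ · b     ≡⟨ ·-++ (replicate n₁ 1ℤ) (replicate n₂ 0ℤ) v ⟨
    system B₁ B₂ zero · v                          ≡⟨ solves zero ⟩
    0ℤ                                             ∎
    where open ≡-Reasoning
  balanced : ∀ i → indicator (B₁ i) · a +ℤ indicator (B₂ i) · b ≡ 0ℤ
  balanced i = trans (sym (·-++ (indicator (B₁ i)) (indicator (B₂ i)) v)) (solves (suc i))

corollary9 : (n₁ n₂ m : ℕ) (B₁ : Fin m → Subset n₁) (B₂ : Fin m → Subset n₂) →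
    IsDecomposition B₁ B₂ →
    ((x : Fin n₁) → ∃ λ i → B₁ i ≡ ⁅ x ⁆) →
    ((x : Fin n₂) → ∃ λ i → B₂ i ≡ ⁅ x ⁆) →
    n₁ + n₂ ≤ m + 1
corollary9 n₁ n₂ m B₁ B₂ decomposition star₁ star₂ =
  subst (n₁ + n₂ ≤_) (ℕ.+-comm 1 m) (only-trivial-solution⇒≤ (system B₁ B₂) only-trivial)
  where
  only-trivial : ∀ v → Solves (system B₁ B₂) v → ∀ l → v l ≡ 0ℤ
  only-trivial v solves
    with system-solution-balanced B₁ B₂ v solves
  ... | ∑a≡0 , balanced
    with balanced-weights-vanish decomposition star₁ star₂ _ _ ∑a≡0 balanced
  ... | a≡0 , b≡0 = ↑-vanishing v a≡0 b≡0
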